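{- For any two distinct vertices $u$ and $v$ of $(\mathrm{TT}(g),J)$ (with $g\ge2$), $f_g\big(ad_{(\mathrm{TT}(g),J)}(u,v)\big)=d_{\mathrm{T}(g)}(u,v)$, where $d_{\mathrm{T}(g)}$ is the graph distance in $\mathrm{T}(g)$.
   Context: Let $a=\lfloor g/2\rfloor$, $b=\lceil g/2\rceil$. $\mathrm{T}(g)$ has vertex set $\{0,\dots,2a-1\}\times\{0,\dots,b-1\}$, with edges $\{(i,j),(i,j+1)\}$ and $\{(i,j),(i',j)\}$ whenever $i-i'\equiv\pm1\pmod{2a}$ (the cylinder $C_{2a}\square P_b$). $\mathrm{TT}(g)$ is obtained from $\mathrm{T}(g)$ by adding the edges $\{(i,0),(i+a\bmod 2a,\,b-1)\}$ joining antipodal vertices; the set of added edges is $J$. In the signed graph $(\mathrm{TT}(g),J)$ the edges of $J$ are negative and all others positive; the sign of a path is the product of its edge signs. For a signed graph $(G,\sigma)$, the algebraic distance $ad_{(G,\sigma)}(u,v)$ equals $d_G(u,v)$ if there is a positive $u$–$v$ path of length $d_G(u,v)$, and $-d_G(u,v)$ otherwise. The function $f_g$ is defined for nonzero integers $x$ with $-\lceil g/2\rceil+1\le x\le \lfloor g/2\rfloor$ by $f_g(x)=x$ if $x>0$ and $f_g(x)=g+x$ otherwise. -}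

module Defs where

open import Data.Nat using (ℕ; zero; suc; _+_; _*_; _∸_; _≤_; ⌊_/2⌋; ⌈_/2⌉)
open import Data.Integer using (ℤ; +_; -[1+_]; -_) renaming (_+_ to _+ℤ_)
open import Data.Fin using (Fin; toℕ)
open import Data.Bool using (Bool; true; false; _xor_)
open import Data.Product using (Σ; ∃; _×_; _,_)
open import Data.Sum using (_⊎_)
open import Relation.Nullary using (¬_)
open import Relation.Binary.PropositionalEquality using (_≡_)

-- Signed graphs (possibly with parallel edges), given by a signed edge
-- relation  E u v s  : "there is an edge u–v of sign s", where the sign
-- Bool records negativity (true = negative edge, false = positive edge).
-- All edge relations below are symmetric by construction (undirected).

SEdges : Set → Set₁
SEdges V = V → V → Bool → Set

-- Walks, indexed by length and by sign (true = odd number of negative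
-- edges, i.e. the walk is negative; false = positive walk).
data Walk {V : Set} (E : SEdges V) : V → V → ℕ → Bool → Set where
  nil  : ∀ {v} → Walk E v v zero false
  cons : ∀ {u v w n s t} → E u v s → Walk E v w n t → Walk E u w (suc n) (s xor t)

Dist : {V : Set} → SEdges V → V → V → ℕ → Set
Dist E u v d = (Σ Bool λ s → Walk E u v d s) × (∀ n s → Walk E u v n s → d ≤ n)

IsAlgDist : {V : Set} → SEdges V → V → V → ℤ → Set
IsAlgDist E u v z =
  Σ ℕ λ d → Dist E u v d ×
    ((Walk E u v d false × z ≡ + d) ⊎ (¬ Walk E u v d false × z ≡ - (+ d)))

a : ℕ → ℕ
a g = ⌊ g /2⌋

b : ℕ → ℕ
b g = ⌈ g /2⌉

V : ℕ → Set
V g = Fin (2 * a g) × Fin (b g)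

SuccMod : ℕ → ℕ → ℕ → Set
SuccMod m i i' = (i' ≡ suc i) ⊎ ((suc i ≡ m) × (i' ≡ zero))

-- edges of the cylinder T(g) = C_{2a} □ P_b
data TEdge (g : ℕ) : V g → V g → Set where
  up    : ∀ {i j j'} → toℕ j' ≡ suc (toℕ j) → TEdge g (i , j) (i , j')
  down  : ∀ {i j j'} → toℕ j ≡ suc (toℕ j') → TEdge g (i , j) (i , j')
  right : ∀ {i i' j} → SuccMod (2 * a g) (toℕ i) (toℕ i') → TEdge g (i , j) (i' , j)
  left  : ∀ {i i' j} → SuccMod (2 * a g) (toℕ i') (toℕ i) → TEdge g (i , j) (i' , j)

-- the antipodal edges J: {(i,0), (i + a mod 2a, b-1)}.
-- For i, i' < 2a:  i' ≡ i + a (mod 2a)  iff  i' ≡ i + a  or  i ≡ i' + a.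
AntiMod : ℕ → ℕ → ℕ → Set
AntiMod a' i i' = (i' ≡ i + a') ⊎ (i ≡ i' + a')

data JEdge (g : ℕ) : V g → V g → Set where
  j-fwd : ∀ {i j i' j'} → toℕ j ≡ 0 → toℕ j' ≡ b g ∸ 1 →
          AntiMod (a g) (toℕ i) (toℕ i') → JEdge g (i , j) (i' , j')
  j-bwd : ∀ {i j i' j'} → toℕ j' ≡ 0 → toℕ j ≡ b g ∸ 1 →
          AntiMod (a g) (toℕ i') (toℕ i) → JEdge g (i , j) (i' , j')

-- T(g) as a signed graph with all edges positive (only used for distances)
T : (g : ℕ) → SEdges (V g)
T g u v s = TEdge g u v × s ≡ false

data TT (g : ℕ) : SEdges (V g) where
  tEdge : ∀ {u v} → TEdge g u v → TT g u v false
  jEdge : ∀ {u v} → JEdge g u v → TT g u v true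

f : ℕ → ℤ → ℤ
f g (+ suc n) = + suc n
f g (+ zero)  = + g
f g -[1+ n ]  = + g +ℤ -[1+ n ]

{-# OPTIONS --safe #-}
-- Write D for the distance in the cylinder T(g) (cyclic offset plus vertical offset).
-- A T-edge changes D(-, v) by at most one, while for an antipodal edge {u, w} one has
-- D(u, v) + D(w, v) + 1 = g: the cyclic offsets of u and w add up to a and their vertical
-- offsets to b - 1.  Hence the potential that is D(-, v) for positive walks and
-- g - D(-, v) for negative walks drops by at most one along each edge, so positive
-- u-v walks have length at least D(u, v) and negative ones at least g - D(u, v).
-- Both bounds are attained: by a shortest path of T(g), and by running along the column
-- of u away from v to the boundary row, crossing the antipodal edge there and finishing
-- with a shortest path of T(g).  So ad(u, v) is D(u, v) or -(g - D(u, v)), and f_g sends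
-- either value to D(u, v).
module Submission where

open import Defs
open import Data.Nat
open import Data.Nat.Properties
open import Data.Nat.Tactic.RingSolver using (solve-∀)
open import Data.Integer as ℤ using (ℤ; +_)
open import Data.Integer.Properties using (⊖-≥)
open import Data.Fin using (Fin; toℕ; fromℕ; fromℕ<)
open import Data.Fin.Properties using (toℕ-injective; toℕ<n; toℕ≤pred[n]; toℕ-fromℕ; toℕ-fromℕ<)
open import Data.Bool using (Bool; true; false; _xor_)
open import Data.Bool.Properties using (xor-assoc; xor-comm; xor-identityʳ)
open import Data.Product using (Σ; _×_; _,_; ∃₂; proj₁; swap)
open import Data.Sum as Sum using (inj₁; inj₂)
open import Function using (_∘_)
open import Relation.Binary.PropositionalEquality
open import Relation.Nullary using (yes; no; ¬_; contradiction)

module _ {X : Set} {E : SEdges X} where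

  castWalk : ∀ {u v m n s} → m ≡ n → Walk E u v m s → Walk E u v n s
  castWalk refl p = p

  _++_ : ∀ {u v w m n s t} → Walk E u v m s → Walk E v w n t → Walk E u w (m + n) (s xor t)
  nil ++ q = q
  cons {s = s} {t = t} e p ++ q = subst (Walk E _ _ _) (sym (xor-assoc s t _)) (cons e (p ++ q))

  reverse : (∀ {x y s} → E x y s → E y x s) →
            ∀ {u v n s} → Walk E u v n s → Walk E v u n s
  reverse E-sym nil = nil
  reverse E-sym {n = suc n} (cons {s = s} {t = t} e p) =
    subst₂ (Walk E _ _) (+-comm n 1) (trans (cong (t xor_) (xor-identityʳ s)) (xor-comm t s))
      (reverse E-sym p ++ cons (E-sym e) nil)

  map-walk : ∀ {E' : SEdges X} → (∀ {x y s} → E x y s → E' x y s) →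
             ∀ {u v n s} → Walk E u v n s → Walk E' u v n s
  map-walk f nil        = nil
  map-walk f (cons e p) = cons (f e) (map-walk f p)

  empty-walk-positive : ∀ {u v s} → Walk E u v 0 s → s ≡ false
  empty-walk-positive nil = refl

  negative-walk-length>0 : ∀ {u v n} → Walk E u v n true → 0 < n
  negative-walk-length>0 {n = zero}  p = contradiction (empty-walk-positive p) λ ()
  negative-walk-length>0 {n = suc n} p = z<s

  ⊓-walk : ∀ {u v m n s} → Walk E u v m s → Walk E u v n s → Walk E u v (m ⊓ n) s
  ⊓-walk {m = m} {n} p q with ⊓-sel m n
  ... | inj₁ m⊓n≡m = castWalk (sym m⊓n≡m) p
  ... | inj₂ m⊓n≡n = castWalk (sym m⊓n≡n) q

  walk-length-≥-potential : ∀ {v} (P : Bool → X → ℕ) → P false v ≡ 0 →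
    (∀ {x y s} → E x y s → ∀ t → P (s xor t) x ≤ suc (P t y)) →
    ∀ {u n s} → Walk E u v n s → P s u ≤ n
  walk-length-≥-potential P P-target P-edge nil = ≤-reflexive P-target
  walk-length-≥-potential P P-target P-edge (cons {t = t} e p) =
    ≤-trans (P-edge e t) (s≤s (walk-length-≥-potential P P-target P-edge p))

  module _ {u v : X} (len : Bool → ℕ) (len-≤ : ∀ {n s} → Walk E u v n s → len s ≤ n) where

    isAlgDist-positive : Walk E u v (len false) false → len false ≤ len true →
                         IsAlgDist E u v (+ len false)
    isAlgDist-positive p⁺ ≤len⁻ = len false , ((false , p⁺) , shortest) , inj₁ (p⁺ , refl)
      where
      shortest : ∀ n s → Walk E u v n s → len false ≤ n
      shortest n false p = len-≤ p
      shortest n true  p = ≤-trans ≤len⁻ (len-≤ p)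

    isAlgDist-negative : Walk E u v (len true) true → len true < len false →
                         IsAlgDist E u v (ℤ.- (+ len true))
    isAlgDist-negative p⁻ <len⁺ = len true , ((true , p⁻) , shortest) , inj₂ (no-positive , refl)
      where
      shortest : ∀ n s → Walk E u v n s → len true ≤ n
      shortest n false p = ≤-trans (<⇒≤ <len⁺) (len-≤ p)
      shortest n true  p = len-≤ p
      no-positive : ¬ Walk E u v (len true) false
      no-positive p = <⇒≱ <len⁺ (len-≤ p)

ascending-walk : ∀ {N} {X : Set} {E : SEdges X} (emb : Fin N → X) →
  (∀ {x x'} → toℕ x' ≡ suc (toℕ x) → E (emb x) (emb x') false) →
  ∀ k {x x'} → toℕ x' ≡ toℕ x + k → Walk E (emb x) (emb x') k false
ascending-walk {E = E} emb step zero {x} x'≡x+0 =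
  subst (λ z → Walk E (emb x) (emb z) 0 false)
        (toℕ-injective (trans (sym (+-identityʳ (toℕ x))) (sym x'≡x+0))) nil
ascending-walk {N} emb step (suc k) {x} {x'} x'≡x+1+k =
  cons (step (toℕ-fromℕ< x+1<N)) (ascending-walk emb step k x'≡[x+1]+k)
  where
  x+1<N : suc (toℕ x) < N
  x+1<N = ≤-<-trans (≤-trans (s≤s (m≤m+n (toℕ x) k)) (≤-reflexive (sym (+-suc (toℕ x) k))))
                    (subst (_< N) x'≡x+1+k (toℕ<n x'))
  x'≡[x+1]+k : toℕ x' ≡ toℕ (fromℕ< x+1<N) + k
  x'≡[x+1]+k = trans x'≡x+1+k (trans (+-suc (toℕ x) k) (cong (_+ k) (sym (toℕ-fromℕ< x+1<N))))

Near : ℕ → ℕ → Set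
Near m n = m ≤ suc n × n ≤ suc m

near-suc : ∀ n → Near n (suc n)
near-suc n = m≤n+m n 2 , ≤-refl

near-sym : ∀ {m n} → Near m n → Near n m
near-sym = swap

+-nearˡ : ∀ k {m n} → Near m n → Near (k + m) (k + n)
+-nearˡ k {m} {n} (m≤1+n , n≤1+m) =
  ≤-trans (+-monoʳ-≤ k m≤1+n) (≤-reflexive (+-suc k n)) ,
  ≤-trans (+-monoʳ-≤ k n≤1+m) (≤-reflexive (+-suc k m))

+-nearʳ : ∀ k {m n} → Near m n → Near (m + k) (n + k)
+-nearʳ k (m≤1+n , n≤1+m) = +-monoˡ-≤ k m≤1+n , +-monoˡ-≤ k n≤1+m

∸-near : ∀ k {m n} → Near m n → Near (k ∸ m) (k ∸ n)
∸-near k {m} {n} (m≤1+n , n≤1+m) = ∸-bound n≤1+m , ∸-bound m≤1+n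
  where
  ∸-bound : ∀ {p q} → q ≤ suc p → k ∸ p ≤ suc (k ∸ q)
  ∸-bound {p} {q} q≤1+p = m≤n+o⇒m∸n≤o k p (begin
    k                   ≤⟨ m≤n+m∸n k q ⟩
    q + (k ∸ q)         ≤⟨ +-monoˡ-≤ (k ∸ q) q≤1+p ⟩
    suc p + (k ∸ q)     ≡⟨ +-suc p (k ∸ q) ⟨
    p + suc (k ∸ q)     ∎)
    where open ≤-Reasoning

⊓-near : ∀ {m n m' n'} → Near m n → Near m' n' → Near (m ⊓ m') (n ⊓ n')
⊓-near (m≤1+n , n≤1+m) (m'≤1+n' , n'≤1+m') = ⊓-mono-≤ m≤1+n m'≤1+n' , ⊓-mono-≤ n≤1+m n'≤1+m'

∣-∣-near-suc : ∀ x y → Near ∣ x - y ∣ ∣ suc x - y ∣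
∣-∣-near-suc zero    zero    = near-suc 0
∣-∣-near-suc zero    (suc y) = near-sym (near-suc y)
∣-∣-near-suc (suc x) zero    = near-suc (suc x)
∣-∣-near-suc (suc x) (suc y) = ∣-∣-near-suc x y

∣-∣-collinear : ∀ {p q r} → p ≤ q → q ≤ r → ∣ p - r ∣ ≡ ∣ p - q ∣ + ∣ q - r ∣
∣-∣-collinear {p} {q} {r} p≤q q≤r = begin
  ∣ p - r ∣                ≡⟨ m≤n⇒∣m-n∣≡n∸m (≤-trans p≤q q≤r) ⟩
  r ∸ p                    ≡⟨ cong (_∸ p) (m∸n+n≡m q≤r) ⟨
  (r ∸ q) + q ∸ p          ≡⟨ +-∸-assoc (r ∸ q) p≤q ⟩
  (r ∸ q) + (q ∸ p)        ≡⟨ +-comm (r ∸ q) (q ∸ p) ⟩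
  (q ∸ p) + (r ∸ q)        ≡⟨ cong₂ _+_ (m≤n⇒∣m-n∣≡n∸m p≤q) (m≤n⇒∣m-n∣≡n∸m q≤r) ⟨
  ∣ p - q ∣ + ∣ q - r ∣    ∎
  where open ≡-Reasoning

∣-∣-collinear′ : ∀ {p q r} → r ≤ q → q ≤ p → ∣ p - r ∣ ≡ ∣ p - q ∣ + ∣ q - r ∣
∣-∣-collinear′ {p} {q} {r} r≤q q≤p = begin
  ∣ p - r ∣                ≡⟨ ∣-∣-comm p r ⟩
  ∣ r - p ∣                ≡⟨ ∣-∣-collinear r≤q q≤p ⟩
  ∣ r - q ∣ + ∣ q - p ∣    ≡⟨ +-comm ∣ r - q ∣ ∣ q - p ∣ ⟩
  ∣ q - p ∣ + ∣ r - q ∣    ≡⟨ cong₂ _+_ (∣-∣-comm q p) (∣-∣-comm r q) ⟩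
  ∣ p - q ∣ + ∣ q - r ∣    ∎
  where open ≡-Reasoning

shorterArc : ℕ → ℕ → ℕ
shorterArc M δ = δ ⊓ (M ∸ δ)

cycDist : ℕ → ℕ → ℕ → ℕ
cycDist M x y = shorterArc M ∣ x - y ∣

cycDist-self : ∀ M x → cycDist M x x ≡ 0
cycDist-self M x = cong (shorterArc M) (∣n-n∣≡0 x)

cycDist≡0⇒≡ : ∀ {M x y} → x < M → y < M → cycDist M x y ≡ 0 → x ≡ y
cycDist≡0⇒≡ {M} {x} {y} x<M y<M arc≡0 = ∣m-n∣≡0⇒m≡n (⊓≡0 (m<n⇒0<n∸m δ<M) arc≡0)
  where
  δ<M : ∣ x - y ∣ < M
  δ<M = ≤-<-trans (∣m-n∣≤m⊔n x y) (⊔-lub x<M y<M)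
  ⊓≡0 : ∀ {m n} → 0 < n → m ⊓ n ≡ 0 → m ≡ 0
  ⊓≡0 {zero} _ _ = refl
  ⊓≡0 {suc m} {suc n} _ ()

shorterArc-near : ∀ M {δ δ'} → Near δ δ' → Near (shorterArc M δ) (shorterArc M δ')
shorterArc-near M δ~δ' = ⊓-near δ~δ' (∸-near M δ~δ')

cycDist-near-succ : ∀ {M x x' y} → SuccMod M x x' → y < M → Near (cycDist M x y) (cycDist M x' y)
cycDist-near-succ {M} {x} {y = y} (inj₁ refl) _ = shorterArc-near M (∣-∣-near-suc x y)
cycDist-near-succ {x = x} {y = y} (inj₂ (refl , refl)) (s≤s y≤x) =
  subst₂ Near (sym last-arc) (sym first-arc)
    (⊓-near (near-suc (x ∸ y)) (near-sym (near-suc y)))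
  where
  open ≡-Reasoning
  last-arc : cycDist (suc x) x y ≡ (x ∸ y) ⊓ suc y
  last-arc = begin
    ∣ x - y ∣ ⊓ (suc x ∸ ∣ x - y ∣)  ≡⟨ cong (λ δ → δ ⊓ (suc x ∸ δ)) (m≤n⇒∣n-m∣≡n∸m y≤x) ⟩
    (x ∸ y) ⊓ (suc x ∸ (x ∸ y))      ≡⟨ cong ((x ∸ y) ⊓_) (+-∸-assoc 1 (m∸n≤m x y)) ⟩
    (x ∸ y) ⊓ suc (x ∸ (x ∸ y))      ≡⟨ cong (λ z → (x ∸ y) ⊓ suc z) (m∸[m∸n]≡n y≤x) ⟩
    (x ∸ y) ⊓ suc y                  ∎
  first-arc : cycDist (suc x) 0 y ≡ suc (x ∸ y) ⊓ y
  first-arc = begin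
    y ⊓ (suc x ∸ y)    ≡⟨ cong (y ⊓_) (+-∸-assoc 1 y≤x) ⟩
    y ⊓ suc (x ∸ y)    ≡⟨ ⊓-comm y (suc (x ∸ y)) ⟩
    suc (x ∸ y) ⊓ y    ∎

module _ (A : ℕ) where

  shorterArc-≤half : ∀ {δ} → δ ≤ A → shorterArc (A + A) δ ≡ δ
  shorterArc-≤half {δ} δ≤A = m≤n⇒m⊓n≡m (begin
    δ              ≤⟨ δ≤A ⟩
    A              ≤⟨ m≤m+n A (A ∸ δ) ⟩
    A + (A ∸ δ)    ≡⟨ +-∸-assoc A δ≤A ⟨
    A + A ∸ δ      ∎)
    where open ≤-Reasoning

  shorterArc-complement : ∀ {δ δ'} → δ + δ' ≡ A → shorterArc (A + A) δ + shorterArc (A + A) δ' ≡ A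
  shorterArc-complement {δ} {δ'} δ+δ'≡A =
    trans (cong₂ _+_ (shorterArc-≤half (subst (δ ≤_) δ+δ'≡A (m≤m+n δ δ')))
                     (shorterArc-≤half (subst (δ' ≤_) δ+δ'≡A (m≤n+m δ' δ))))
          δ+δ'≡A

  shorterArc-opposite : ∀ {δ} → δ ≤ A → shorterArc (A + A) δ + shorterArc (A + A) (δ + A) ≡ A
  shorterArc-opposite {δ} δ≤A = begin
    shorterArc (A + A) δ + shorterArc (A + A) (δ + A)  ≡⟨ cong₂ _+_ (shorterArc-≤half δ≤A) opposite-arc ⟩
    δ + (A ∸ δ)                                        ≡⟨ m+[n∸m]≡n δ≤A ⟩
    A                                                  ∎
    where
    open ≡-Reasoning
    A+A∸[δ+A]≡A∸δ : A + A ∸ (δ + A) ≡ A ∸ δ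
    A+A∸[δ+A]≡A∸δ = trans (cong (A + A ∸_) (+-comm δ A)) ([m+n]∸[m+o]≡n∸o A A δ)
    opposite-arc : shorterArc (A + A) (δ + A) ≡ A ∸ δ
    opposite-arc = trans (cong ((δ + A) ⊓_) A+A∸[δ+A]≡A∸δ)
                         (m≥n⇒m⊓n≡n (≤-trans (m∸n≤m A δ) (m≤n+m A δ)))

  private
    arc : ℕ → ℕ
    arc = shorterArc (A + A)

  cycDist-antipodal : ∀ {x y} → x < A → y < A + A →
                      cycDist (A + A) x y + cycDist (A + A) (x + A) y ≡ A
  cycDist-antipodal {x} {y} x<A y<A+A with ≤-total y x
  ... | inj₁ y≤x = begin
    arc ∣ x - y ∣ + arc ∣ x + A - y ∣        ≡⟨ cong₂ (λ δ δ' → arc δ + arc δ') (∣-∣-comm x y) x+A-y ⟩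
    arc ∣ y - x ∣ + arc (∣ y - x ∣ + A)      ≡⟨ shorterArc-opposite δ≤A ⟩
    A                                        ∎
    where
    open ≡-Reasoning
    x+A-y : ∣ x + A - y ∣ ≡ ∣ y - x ∣ + A
    x+A-y = trans (∣-∣-comm (x + A) y)
                  (trans (∣-∣-collinear y≤x (m≤m+n x A)) (cong (_+_ ∣ y - x ∣) (∣m-m+n∣≡n x A)))
    δ≤A : ∣ y - x ∣ ≤ A
    δ≤A = ≤-trans (∣m-n∣≤m⊔n y x) (⊔-lub (≤-trans y≤x (<⇒≤ x<A)) (<⇒≤ x<A))
  ... | inj₂ x≤y with ≤-total y (x + A)
  ...   | inj₁ y≤x+A = shorterArc-complement {∣ x - y ∣} {∣ x + A - y ∣} (begin
    ∣ x - y ∣ + ∣ x + A - y ∣     ≡⟨ cong (_+_ ∣ x - y ∣) (∣-∣-comm (x + A) y) ⟩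
    ∣ x - y ∣ + ∣ y - x + A ∣     ≡⟨ ∣-∣-collinear x≤y y≤x+A ⟨
    ∣ x - x + A ∣                 ≡⟨ ∣m-m+n∣≡n x A ⟩
    A                             ∎)
    where open ≡-Reasoning
  ...   | inj₂ x+A≤y = begin
    arc ∣ x - y ∣ + arc δ               ≡⟨ cong (λ δ' → arc δ' + arc δ) x-y ⟩
    arc (A + δ) + arc δ                 ≡⟨ +-comm (arc (A + δ)) (arc δ) ⟩
    arc δ + arc (A + δ)                 ≡⟨ cong (λ δ' → arc δ + arc δ') (+-comm A δ) ⟩
    arc δ + arc (δ + A)                 ≡⟨ shorterArc-opposite (<⇒≤ δ<A) ⟩
    A                                   ∎
    where
    open ≡-Reasoning
    δ : ℕ
    δ = ∣ x + A - y ∣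
    x-y : ∣ x - y ∣ ≡ A + δ
    x-y = trans (∣-∣-collinear (m≤m+n x A) x+A≤y) (cong (_+ δ) (∣m-m+n∣≡n x A))
    δ<A : δ < A
    δ<A = +-cancelˡ-< A δ A (subst (_< A + A) x-y
            (≤-<-trans (∣m-n∣≤m⊔n x y) (⊔-lub (<-≤-trans x<A (m≤m+n A A)) y<A+A)))

  cycDist-AntiMod : ∀ {x x' y} → AntiMod A x x' → x < A + A → x' < A + A → y < A + A →
                           cycDist (A + A) x y + cycDist (A + A) x' y ≡ A
  cycDist-AntiMod {x} (inj₁ refl) _ x+A<A+A y<A+A =
    cycDist-antipodal (+-cancelʳ-< A x A x+A<A+A) y<A+A
  cycDist-AntiMod {x' = x'} {y} (inj₂ refl) x'+A<A+A _ y<A+A =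
    trans (+-comm (cycDist (A + A) (x' + A) y) (cycDist (A + A) x' y))
          (cycDist-antipodal (+-cancelʳ-< A x' A x'+A<A+A) y<A+A)

around-length : ∀ {x x' m} → x ≤ x' → x' ≤ m → (m ∸ x') + suc x ≡ suc m ∸ (x' ∸ x)
around-length {x} {x'} {m} x≤x' x'≤m =
  trans (sym (m+n∸n≡m ((m ∸ x') + suc x) (x' ∸ x))) (cong (_∸ (x' ∸ x)) (begin
    (m ∸ x') + suc x + (x' ∸ x)      ≡⟨ regroup (m ∸ x') x (x' ∸ x) ⟩
    suc ((m ∸ x') + (x + (x' ∸ x)))  ≡⟨ cong (λ k → suc ((m ∸ x') + k)) (m+[n∸m]≡n x≤x') ⟩
    suc ((m ∸ x') + x')              ≡⟨ cong suc (m∸n+n≡m x'≤m) ⟩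
    suc m                            ∎))
  where
  open ≡-Reasoning
  regroup : ∀ r x δ → r + suc x + δ ≡ suc (r + (x + δ))
  regroup = solve-∀

column-span : ∀ {y top} → y ≤ top → ∣ 0 - y ∣ + ∣ top - y ∣ ≡ top
column-span {y} {top} y≤top =
  trans (cong (_+_ y) (∣-∣-comm top y)) (sym (∣-∣-collinear z≤n y≤top))

Fin-first : ∀ {n} → Fin n → Σ (Fin n) λ lo → toℕ lo ≡ 0
Fin-first {suc n} _ = Fin.zero , refl

Fin-last : ∀ {n} → Fin n → Σ (Fin n) λ hi → suc (toℕ hi) ≡ n
Fin-last {suc n} _ = fromℕ n , cong suc (toℕ-fromℕ n)

f-positive : ∀ g {d} → 0 < d → f g (+ d) ≡ + d
f-positive g {suc d} _ = refl

f-negative : ∀ g {n} → 0 < n → n ≤ g → f g (ℤ.- (+ n)) ≡ + (g ∸ n)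
f-negative g {suc n} _ = ⊖-≥

module Cylinder (g : ℕ) where

  private
    A B M : ℕ
    A = a g
    B = b g
    M = 2 * A

    M≡A+A : M ≡ A + A
    M≡A+A = cong (_+_ A) (+-identityʳ A)

  cylDist : V g → V g → ℕ
  cylDist (i , j) (i' , j') = cycDist M (toℕ i) (toℕ i') + ∣ toℕ j - toℕ j' ∣

  cylDist-self : ∀ u → cylDist u u ≡ 0
  cylDist-self (i , j) = cong₂ _+_ (cycDist-self M (toℕ i)) (∣n-n∣≡0 (toℕ j))

  cylDist≡0⇒≡ : ∀ {u v} → cylDist u v ≡ 0 → u ≡ v
  cylDist≡0⇒≡ {i , j} {i' , j'} d≡0 = cong₂ _,_
    (toℕ-injective (cycDist≡0⇒≡ (toℕ<n i) (toℕ<n i') (m+n≡0⇒m≡0 _ d≡0)))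
    (toℕ-injective (∣m-n∣≡0⇒m≡n (m+n≡0⇒n≡0 _ d≡0)))

  TEdge-sym : ∀ {u w} → TEdge g u w → TEdge g w u
  TEdge-sym (up e)    = down e
  TEdge-sym (down e)  = up e
  TEdge-sym (right e) = left e
  TEdge-sym (left e)  = right e

  private
    near-up : ∀ i {j j'} → toℕ j' ≡ suc (toℕ j) → ∀ v → Near (cylDist (i , j) v) (cylDist (i , j') v)
    near-up i {j} e (i₂ , j₂) =
      subst (λ y → Near (c + ∣ toℕ j - toℕ j₂ ∣) (c + ∣ y - toℕ j₂ ∣)) (sym e)
            (+-nearˡ c (∣-∣-near-suc (toℕ j) (toℕ j₂)))
      where
      c : ℕ
      c = cycDist M (toℕ i) (toℕ i₂)

    near-right : ∀ {i i'} j → SuccMod M (toℕ i) (toℕ i') → ∀ v → Near (cylDist (i , j) v) (cylDist (i' , j) v)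
    near-right j e (i₂ , j₂) = +-nearʳ ∣ toℕ j - toℕ j₂ ∣ (cycDist-near-succ e (toℕ<n i₂))

  cylDist-near : ∀ {u w} → TEdge g u w → ∀ v → Near (cylDist u v) (cylDist w v)
  cylDist-near (up {i} e)    v = near-up i e v
  cylDist-near (down {i} e)  v = near-sym (near-up i e v)
  cylDist-near (right {j = j} e) v = near-right j e v
  cylDist-near (left {j = j} e)  v = near-sym (near-right j e v)

  private
    antipodal-sum : ∀ {i i' j j'} → toℕ j ≡ 0 → toℕ j' ≡ B ∸ 1 → AntiMod A (toℕ i) (toℕ i') →
                    ∀ v → suc (cylDist (i , j) v + cylDist (i' , j') v) ≡ g
    antipodal-sum {i} {i'} {j} {j'} j≡0 j'≡top i~i' (i₂ , j₂) = begin
      suc (c + ∣ toℕ j - y ∣ + (c' + ∣ toℕ j' - y ∣))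
        ≡⟨ cong₂ (λ p q → suc (c + ∣ p - y ∣ + (c' + ∣ q - y ∣))) j≡0 j'≡top ⟩
      suc (c + ∣ 0 - y ∣ + (c' + ∣ B ∸ 1 - y ∣))
        ≡⟨ regroup c c' ∣ 0 - y ∣ ∣ B ∸ 1 - y ∣ ⟩
      (c + c') + suc (∣ 0 - y ∣ + ∣ B ∸ 1 - y ∣)
        ≡⟨ cong₂ (λ p q → p + suc q) cyclic-part (column-span y≤top) ⟩
      A + suc (B ∸ 1)
        ≡⟨ cong (_+_ A) (m+[n∸m]≡n (≤-<-trans z≤n (toℕ<n j₂))) ⟩
      A + B
        ≡⟨ ⌊n/2⌋+⌈n/2⌉≡n g ⟩
      g ∎
      where
      open ≡-Reasoning
      regroup : ∀ c c' p q → suc (c + p + (c' + q)) ≡ (c + c') + suc (p + q)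
      regroup = solve-∀
      y c c' : ℕ
      y = toℕ j₂
      c = cycDist M (toℕ i) (toℕ i₂)
      c' = cycDist M (toℕ i') (toℕ i₂)
      <A+A : ∀ (k : Fin M) → toℕ k < A + A
      <A+A k = subst (toℕ k <_) M≡A+A (toℕ<n k)
      cyclic-part : c + c' ≡ A
      cyclic-part = subst (λ m → cycDist m (toℕ i) (toℕ i₂) + cycDist m (toℕ i') (toℕ i₂) ≡ A) (sym M≡A+A)
                      (cycDist-AntiMod A i~i' (<A+A i) (<A+A i') (<A+A i₂))
      y≤top : y ≤ B ∸ 1
      y≤top = subst (y ≤_) (pred[m∸n]≡m∸[1+n] B 0) (toℕ≤pred[n] j₂)

  cylDist-JEdge : ∀ {u w} → JEdge g u w → ∀ v → suc (cylDist u v + cylDist w v) ≡ g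
  cylDist-JEdge (j-fwd j≡0 j'≡top i~i') v = antipodal-sum j≡0 j'≡top i~i' v
  cylDist-JEdge (j-bwd {i} {j} j'≡0 j≡top i'~i) v =
    trans (cong suc (+-comm (cylDist (i , j) v) _)) (antipodal-sum j'≡0 j≡top i'~i v)

  T-sym : ∀ {x y s} → T g x y s → T g y x s
  T-sym (e , s≡false) = TEdge-sym e , s≡false

  private
    right-walk : ∀ {i i'} j → toℕ i ≤ toℕ i' → Walk (T g) (i , j) (i' , j) (toℕ i' ∸ toℕ i) false
    right-walk j i≤i' =
      ascending-walk (_, j) (λ e → right (inj₁ e) , refl) _ (sym (m+[n∸m]≡n i≤i'))

    up-walk : ∀ i {j j'} → toℕ j ≤ toℕ j' → Walk (T g) (i , j) (i , j') (toℕ j' ∸ toℕ j) false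
    up-walk i j≤j' = ascending-walk (i ,_) (λ e → up e , refl) _ (sym (m+[n∸m]≡n j≤j'))

    around-walk : ∀ {i i'} j → toℕ i ≤ toℕ i' → Walk (T g) (i' , j) (i , j) (M ∸ (toℕ i' ∸ toℕ i)) false
    around-walk {i} {i'} j i≤i' with Fin-first i | Fin-last i
    ... | first , first≡0 | last , last+1≡M =
      castWalk length-eq
        (right-walk j i'≤last ++
           cons (right (inj₂ (last+1≡M , first≡0)) , refl)
                (right-walk j (subst (_≤ toℕ i) (sym first≡0) z≤n)))
      where
      i'≤last : toℕ i' ≤ toℕ last
      i'≤last = s≤s⁻¹ (subst (toℕ i' <_) (sym last+1≡M) (toℕ<n i'))
      length-eq : (toℕ last ∸ toℕ i') + suc (toℕ i ∸ toℕ first) ≡ M ∸ (toℕ i' ∸ toℕ i)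
      length-eq = trans (cong (λ k → (toℕ last ∸ toℕ i') + suc (toℕ i ∸ k)) first≡0)
                        (trans (around-length i≤i' i'≤last) (cong (_∸ (toℕ i' ∸ toℕ i)) last+1≡M))

  row-walk : ∀ (i i' : Fin M) j → Walk (T g) (i , j) (i' , j) (cycDist M (toℕ i) (toℕ i')) false
  row-walk i i' j with ≤-total (toℕ i) (toℕ i')
  ... | inj₁ i≤i' = castWalk (cong (shorterArc M) (sym (m≤n⇒∣m-n∣≡n∸m i≤i')))
                      (⊓-walk (right-walk j i≤i') (reverse T-sym (around-walk j i≤i')))
  ... | inj₂ i'≤i = castWalk (cong (shorterArc M) (sym (m≤n⇒∣n-m∣≡n∸m i'≤i)))
                      (⊓-walk (reverse T-sym (right-walk j i'≤i)) (around-walk j i'≤i))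

  column-walk : ∀ i (j j' : Fin B) → Walk (T g) (i , j) (i , j') ∣ toℕ j - toℕ j' ∣ false
  column-walk i j j' with ≤-total (toℕ j) (toℕ j')
  ... | inj₁ j≤j' = castWalk (sym (m≤n⇒∣m-n∣≡n∸m j≤j')) (up-walk i j≤j')
  ... | inj₂ j'≤j = castWalk (sym (m≤n⇒∣n-m∣≡n∸m j'≤j)) (reverse T-sym (up-walk i j'≤j))

  T-walk : ∀ u v → Walk (T g) u v (cylDist u v) false
  T-walk (i , j) (i' , j') = row-walk i i' j ++ column-walk i' j j'

  T-walk-length-≥ : ∀ {u v n s} → Walk (T g) u v n s → cylDist u v ≤ n
  T-walk-length-≥ {v = v} =
    walk-length-≥-potential (λ _ x → cylDist x v) (cylDist-self v) (λ (e , _) _ → proj₁ (cylDist-near e v))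

  potential : Bool → V g → V g → ℕ
  potential false u v = cylDist u v
  potential true  u v = g ∸ cylDist u v

  TT-walk-length-≥ : ∀ {u v n s} → Walk (TT g) u v n s → potential s u v ≤ n
  TT-walk-length-≥ {v = v} = walk-length-≥-potential (λ s x → potential s x v) (cylDist-self v) step
    where
    complement : ∀ {m n k} → suc (m + n) ≡ k → k ∸ m ≡ suc n
    complement {m} {n} refl = trans (cong (_∸ m) (sym (+-suc m n))) (m+n∸m≡n m (suc n))
    step : ∀ {x y s} → TT g x y s → ∀ t → potential (s xor t) x v ≤ suc (potential t y v)
    step (tEdge e) false = proj₁ (cylDist-near e v)
    step (tEdge e) true  = proj₁ (∸-near g (cylDist-near e v))
    step {x} (jEdge e) false = ≤-reflexive (complement {cylDist x v} (cylDist-JEdge e v))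
    step {x} {y} (jEdge e) true =
      subst (λ k → cylDist x v ≤ suc k)
        (sym (complement {cylDist y v} (trans (cong suc (+-comm (cylDist y v) (cylDist x v))) (cylDist-JEdge e v))))
        (m≤n+m (cylDist x v) 2)

  antipode : (i : Fin M) → Σ (Fin M) λ i' → AntiMod A (toℕ i) (toℕ i')
  antipode i with toℕ i <? A
  ... | yes i<A = fromℕ< i+A<M , inj₁ (toℕ-fromℕ< i+A<M)
    where
    i+A<M : toℕ i + A < M
    i+A<M = subst (toℕ i + A <_) (sym M≡A+A) (+-monoˡ-< A i<A)
  ... | no i≮A = fromℕ< i∸A<M , inj₂ (sym (trans (cong (_+ A) (toℕ-fromℕ< i∸A<M)) (m∸n+n≡m (≮⇒≥ i≮A))))
    where
    i∸A<M : toℕ i ∸ A < M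
    i∸A<M = ≤-<-trans (m∸n≤m (toℕ i) A) (toℕ<n i)

  T⊆TT : ∀ {x y n s} → Walk (T g) x y n s → Walk (TT g) x y n s
  T⊆TT = map-walk λ { (e , refl) → tEdge e }

  private
    negative-walk-via : ∀ {u u₀ w v ℓ} → Walk (T g) u u₀ ℓ false → ℓ + cylDist u v ≡ cylDist u₀ v →
                        JEdge g u₀ w → Σ ℕ λ N → Walk (TT g) u v N true × N + cylDist u v ≡ g
    negative-walk-via {u} {u₀} {w} {v} {ℓ} p ℓ+d≡d₀ e =
      ℓ + suc (cylDist w v) , T⊆TT p ++ cons (jEdge e) (T⊆TT (T-walk w v)) , (begin
        ℓ + suc d' + d          ≡⟨ regroup ℓ d' d ⟩
        suc ((ℓ + d) + d')      ≡⟨ cong (λ k → suc (k + d')) ℓ+d≡d₀ ⟩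
        suc (cylDist u₀ v + d') ≡⟨ cylDist-JEdge e v ⟩
        g                       ∎)
      where
      open ≡-Reasoning
      d d' : ℕ
      d = cylDist u v
      d' = cylDist w v
      regroup : ∀ ℓ d' d → ℓ + suc d' + d ≡ suc ((ℓ + d) + d')
      regroup = solve-∀

    column-detour : ∀ c y y' y₀ → ∣ y₀ - y' ∣ ≡ ∣ y₀ - y ∣ + ∣ y - y' ∣ →
                    ∣ y - y₀ ∣ + (c + ∣ y - y' ∣) ≡ c + ∣ y₀ - y' ∣
    column-detour c y y' y₀ collinear = begin
      ∣ y - y₀ ∣ + (c + ∣ y - y' ∣)    ≡⟨ cong (_+ (c + ∣ y - y' ∣)) (∣-∣-comm y y₀) ⟩
      ∣ y₀ - y ∣ + (c + ∣ y - y' ∣)    ≡⟨ +-comm-middle ∣ y₀ - y ∣ c ∣ y - y' ∣ ⟩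
      c + (∣ y₀ - y ∣ + ∣ y - y' ∣)    ≡⟨ cong (_+_ c) collinear ⟨
      c + ∣ y₀ - y' ∣                  ∎
      where
      open ≡-Reasoning
      +-comm-middle : ∀ p c q → p + (c + q) ≡ c + (p + q)
      +-comm-middle = solve-∀

    negative-walk-of-length : ∀ u v → Σ ℕ λ N → Walk (TT g) u v N true × N + cylDist u v ≡ g
    negative-walk-of-length (i , j) (i' , j')
      with Fin-first j | Fin-last j | antipode i | ≤-total (toℕ j) (toℕ j')
    ... | bottom , bottom≡0 | top , top+1≡B | iₐ , i~iₐ | inj₁ j≤j' =
      negative-walk-via (column-walk i j bottom)
        (column-detour (cycDist M (toℕ i) (toℕ i')) (toℕ j) (toℕ j') (toℕ bottom)
          (∣-∣-collinear (subst (_≤ toℕ j) (sym bottom≡0) z≤n) j≤j'))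
        (j-fwd {j' = top} bottom≡0 (cong (_∸ 1) top+1≡B) i~iₐ)
    ... | bottom , bottom≡0 | top , top+1≡B | iₐ , i~iₐ | inj₂ j'≤j =
      negative-walk-via (column-walk i j top)
        (column-detour (cycDist M (toℕ i) (toℕ i')) (toℕ j) (toℕ j') (toℕ top)
          (∣-∣-collinear′ j'≤j (s≤s⁻¹ (subst (toℕ j <_) (sym top+1≡B) (toℕ<n j)))))
        (j-bwd {j' = bottom} bottom≡0 (cong (_∸ 1) top+1≡B) (Sum.swap i~iₐ))

  negative-walk : ∀ u v → Walk (TT g) u v (g ∸ cylDist u v) true
  negative-walk u v with negative-walk-of-length u v
  ... | N , p , N+d≡g = castWalk (trans (sym (m+n∸n≡m N (cylDist u v))) (cong (_∸ cylDist u v) N+d≡g)) p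

  T-distance : ∀ u v → Dist (T g) u v (cylDist u v)
  T-distance u v = (false , T-walk u v) , λ _ _ → T-walk-length-≥

  algebraic-distance : ∀ {u v} → u ≢ v → Σ ℤ λ z → IsAlgDist (TT g) u v z × f g z ≡ + cylDist u v
  algebraic-distance {u} {v} u≢v with cylDist u v ≤? g ∸ cylDist u v
  ... | yes d≤g∸d =
    + d , isAlgDist-positive (λ s → potential s u v) TT-walk-length-≥ (T⊆TT (T-walk u v)) d≤g∸d ,
    f-positive g (n≢0⇒n>0 (u≢v ∘ cylDist≡0⇒≡))
    where
    d : ℕ
    d = cylDist u v
  ... | no d≰g∸d =
    ℤ.- (+ (g ∸ d)) , isAlgDist-negative (λ s → potential s u v) TT-walk-length-≥ p⁻ (≰⇒> d≰g∸d) ,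
    trans (f-negative g g∸d>0 (m∸n≤m g d)) (cong +_ (m∸[m∸n]≡n d≤g))
    where
    d : ℕ
    d = cylDist u v
    p⁻ : Walk (TT g) u v (g ∸ d) true
    p⁻ = negative-walk u v
    g∸d>0 : 0 < g ∸ d
    g∸d>0 = negative-walk-length>0 p⁻
    d≤g : d ≤ g
    d≤g = <⇒≤ (m∸n≢0⇒n<m (m<n⇒n≢0 g∸d>0))

lemma6 : (g : ℕ) → 2 ≤ g → (u v : V g) → u ≢ v →
    ∃₂ λ (z : ℤ) (d : ℕ) → IsAlgDist (TT g) u v z × Dist (T g) u v d × f g z ≡ + d
lemma6 g _ u v u≢v =
  let open Cylinder g
      (z , z-is-ad , f[z]≡d) = algebraic-distance u≢v
  in z , cylDist u v , z-is-ad , T-distance u v , f[z]≡d
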